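{- For positive integers $m,n$, $RR(B_m,B_n)\le \sum_{i=1}^{2^n-1}R_i(B_m)$.
   Context: For a positive integer $N$, $\mathcal{B}_N$ denotes the Boolean lattice of all subsets of $[N]=\{1,\dots,N\}$ ordered by inclusion. A family $\mathcal{G}$ of sets is a copy of a poset $P$ if there is a bijection $\phi:P\to\mathcal{G}$ with $x<_P y$ if and only if $\phi(x)\subsetneq\phi(y)$. A coloring of $\mathcal{B}_N$ is any map from $\mathcal{B}_N$ to the positive integers; a $k$-coloring is a map to $[k]$. Under a coloring, a monochromatic $P$ is a copy of $P$ all of whose sets have the same color, and a rainbow $Q$ is a copy of $Q$ whose sets have pairwise distinct colors. $RR(P,Q)$ is the minimum integer $N$ such that every coloring of $\mathcal{B}_N$ contains a monochromatic $P$ or a rainbow $Q$. The Boolean Ramsey number $R_k(P)$ is the minimum integer $N$ such that every $k$-coloring of $\mathcal{B}_N$ contains a monochromatic $P$. $B_k$ denotes the poset isomorphic to $\mathcal{B}_k$. -}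

module Defs where

open import Data.Nat using (ℕ; zero; suc; _+_; _≤_)
open import Data.Fin using (Fin)
open import Data.Fin.Subset using (Subset; _⊂_)
open import Data.Product using (Σ; _×_; ∃)
open import Function.Definitions using (Injective)
open import Relation.Binary.PropositionalEquality using (_≡_)
open import Function.Bundles using (_⇔_)
open import Data.Sum using (_⊎_)

record CopyOfB (k N : ℕ) : Set where
  field
    φ     : Subset k → Subset N
    inj   : Injective _≡_ _≡_ φ
    order : ∀ x y → (x ⊂ y) ⇔ (φ x ⊂ φ y)
open CopyOfB public

HasMonoB : {C : Set} (k N : ℕ) → (Subset N → C) → Set
HasMonoB k N c = Σ (CopyOfB k N) λ G → ∀ x y → c (φ G x) ≡ c (φ G y)

HasRainbowB : {C : Set} (k N : ℕ) → (Subset N → C) → Set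
HasRainbowB k N c = Σ (CopyOfB k N) λ G → Injective _≡_ _≡_ (λ x → c (φ G x))

-- Property defining RR(B_m,B_n): every coloring of B_N (colors in ℕ,
-- an arbitrary relabelling of the positive integers) contains a
-- monochromatic B_m or a rainbow B_n.
RRProp : ℕ → ℕ → ℕ → Set
RRProp m n N = (c : Subset N → ℕ) → HasMonoB m N c ⊎ HasRainbowB n N c

RProp : ℕ → ℕ → ℕ → Set
RProp k m N = (c : Subset N → Fin k) → HasMonoB m N c

IsMin : (ℕ → Set) → ℕ → Set
IsMin P N = P N × (∀ M → P M → N ≤ M)

sumFrom1 : (ℕ → ℕ) → ℕ → ℕ
sumFrom1 f zero = zero
sumFrom1 f (suc K) = sumFrom1 f K + f (suc K)

-- Let K = 2^n − 1 and S = R 1 + ⋯ + R K, and cut [S] into consecutive blocks of sizes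
-- R 1, …, R K. Subsets of [n] are numbered 0, …, K by their binary code, ∅ getting 0.
-- For z ⊆ [n] and w inside the block of z, ψ z w fills every block of a proper
-- subset of z and puts w into the block of z; z ↦ ψ z (W z) is then a copy of B_n
-- as soon as W is nonempty on atoms. Choose the W z greedily by increasing code,
-- each time with a colour not used before. If this is impossible at code j, the
-- copy ψ z (B_{R j}) of B_{R j} only uses the at most j earlier colours, so it
-- contains a monochromatic B_m by the definition of R j. Otherwise the choices
-- form a rainbow B_n (an atom with W z = ∅ would repeat the colour of ∅).
--
-- The minimum in RR(B_m,B_n) is found by bounded search, which needs RRProp to be
-- decidable: copies are maps between finite lattices, and a colouring matters only
-- through its kernel, which some colouring of B_N with colours in B_N also has.

module Submission where

open import Defs
open import Data.Nat using (ℕ; zero; suc; _+_; _^_; _∸_; _≤_; _<_; z≤n; s≤s; _≟_)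
open import Data.Nat.Properties
  using (≤-refl; ≤-trans; <-≤-trans; <⇒≤; <⇒≢; ≮⇒≥; +-cancelˡ-≡; +-monoʳ-<; m≤m+n; +-identityʳ;
         suc[m]≤n⇒m≤pred[n]; pred[m∸n]≡m∸[1+n]; m<1+n⇒m<n∨m≡n; m≤n⇒m<n∨m≡n;
         m≤n⇒m≤1+n; ≤-pred; _<?_; anyUpTo?)
open import Data.Nat.Induction using (<-rec)
open import Data.Bool using () renaming (_≟_ to _≟ᵇ_)
open import Data.Vec using ([]; _∷_; _++_; here; there)
open import Data.Vec.Properties using (≡-dec)
open import Data.Fin using (Fin; zero; toℕ; fromℕ<)
open import Data.Fin.Properties using (toℕ-fromℕ<; ¬∀⟶∃¬)
open import Data.Fin.Subset
  using (Subset; inside; outside; _∈_; _∉_; _⊆_; _⊈_; _⊂_; ⁅_⁆) renaming (⊥ to ∅; ⊤ to full)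
open import Data.Fin.Subset.Properties
  using (_∈?_; _⊆?_; ⊆-refl; ⊆-reflexive; ⊆-antisym; ⊂-trans; ⊂-irref; drop-∷-⊆; Empty-unique;
         x∈⁅x⁆; x∈⁅y⁆⇒x≡y; ∉⊥; ∈⊤; ⊥⊆; ⊆⊤; _⊂?_; anySubset?)
open import Data.Product using (Σ; ∃; ∃-syntax; _×_; _,_; proj₁; proj₂)
open import Data.Sum using (_⊎_; inj₁; inj₂)
open import Data.Empty using (⊥-elim)
open import Function using (_∘_)
open import Function.Bundles using (_⇔_; mk⇔; Equivalence)
open import Function.Definitions using (Injective)
open import Relation.Nullary using (¬_; Dec; yes; no; contradiction)
open import Relation.Nullary.Decidable using (map′; ¬?; _×-dec_; _⊎-dec_; _→-dec_; decidable-stable)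
open import Relation.Unary using (Decidable)
open import Relation.Binary.Definitions using (DecidableEquality)
open import Relation.Binary.PropositionalEquality
  using (_≡_; _≢_; refl; sym; trans; cong; subst; subst₂; _≗_; module ≡-Reasoning)

open Equivalence using (to; from)

private variable
  k N : ℕ

_≟ₛ_ : DecidableEquality (Subset k)
_≟ₛ_ = ≡-dec _≟ᵇ_

⊈⇒∃∈∉ : {p q : Subset k} → p ⊈ q → ∃[ x ] x ∈ p × x ∉ q
⊈⇒∃∈∉ {k} {p} {q} p⊈q with ¬∀⟶∃¬ k (λ x → x ∈ p → x ∈ q) (λ x → x ∈? p →-dec x ∈? q) (λ h → p⊈q (h _))
... | x , x∉ = x , decidable-stable (x ∈? p) (λ x∉p → x∉ (⊥-elim ∘ x∉p)) , x∉ ∘ λ x∈q _ → x∈q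

⊂⇔⊆×≢ : {p q : Subset k} → p ⊂ q ⇔ (p ⊆ q × p ≢ q)
⊂⇔⊆×≢ = mk⇔ (λ p⊂q → proj₁ p⊂q , λ p≡q → ⊂-irref p≡q p⊂q)
              (λ (p⊆q , p≢q) → p⊆q , ⊈⇒∃∈∉ (p≢q ∘ ⊆-antisym p⊆q))

∷-⊆ : ∀ {s t} {p q : Subset k} {p′ q′ : Subset N} → s ∷ p ⊆ t ∷ q → p′ ⊆ q′ → s ∷ p′ ⊆ t ∷ q′
∷-⊆ h h′ here with h here
... | here = here
∷-⊆ h h′ (there x∈p′) = there (h′ x∈p′)

++-⊆⁺ : {p p′ : Subset k} {q q′ : Subset N} → p ⊆ p′ → q ⊆ q′ → p ++ q ⊆ p′ ++ q′
++-⊆⁺ {p = []} {[]} _ q⊆q′ = q⊆q′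
++-⊆⁺ {p = _ ∷ _} {_ ∷ _} p⊆p′ q⊆q′ = ∷-⊆ p⊆p′ (++-⊆⁺ (drop-∷-⊆ p⊆p′) q⊆q′)

++-⊆⁻ˡ : {p p′ : Subset k} {q q′ : Subset N} → p ++ q ⊆ p′ ++ q′ → p ⊆ p′
++-⊆⁻ˡ {p = []} {[]} _ = ⊆-refl
++-⊆⁻ˡ {p = _ ∷ _} {_ ∷ _} h = ∷-⊆ h (++-⊆⁻ˡ (drop-∷-⊆ h))

++-⊆⁻ʳ : {p p′ : Subset k} {q q′ : Subset N} → p ++ q ⊆ p′ ++ q′ → q ⊆ q′
++-⊆⁻ʳ {p = []} {[]} h = h
++-⊆⁻ʳ {p = _ ∷ p} {_ ∷ p′} h = ++-⊆⁻ʳ {p = p} {p′} (drop-∷-⊆ h)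

x∈p⇒⁅x⁆⊆p : {x : Fin k} {p : Subset k} → x ∈ p → ⁅ x ⁆ ⊆ p
x∈p⇒⁅x⁆⊆p {x = x} x∈p y∈⁅x⁆ = subst (_∈ _) (sym (x∈⁅y⁆⇒x≡y x y∈⁅x⁆)) x∈p

⊂⁅x⁆⇒≡∅ : {x : Fin k} {p : Subset k} → p ⊂ ⁅ x ⁆ → p ≡ ∅
⊂⁅x⁆⇒≡∅ {x = x} {p} (p⊆⁅x⁆ , y , y∈⁅x⁆ , y∉p) = Empty-unique λ (z , z∈p) →
  y∉p (subst (_∈ p) (trans (x∈⁅y⁆⇒x≡y x (p⊆⁅x⁆ z∈p)) (sym (x∈⁅y⁆⇒x≡y x y∈⁅x⁆))) z∈p)

⁅x⁆≢∅ : {x : Fin k} → ⁅ x ⁆ ≢ ∅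
⁅x⁆≢∅ {x = x} e = ∉⊥ (subst (x ∈_) e (x∈⁅x⁆ x))

full⊈∅ : 1 ≤ k → full {k} ⊈ ∅
full⊈∅ (s≤s _) h = ∉⊥ (h (∈⊤ {x = zero}))

OrderEmbedding : (Subset k → Subset N) → Set
OrderEmbedding f = ∀ x y → x ⊆ y ⇔ f x ⊆ f y

orderEmbedding-injective : {f : Subset k → Subset N} → OrderEmbedding f → Injective _≡_ _≡_ f
orderEmbedding-injective e fx≡fy =
  ⊆-antisym (from (e _ _) (⊆-reflexive fx≡fy)) (from (e _ _) (⊆-reflexive (sym fx≡fy)))

orderEmbedding⇒copy : (f : Subset k → Subset N) → OrderEmbedding f → CopyOfB k N
orderEmbedding⇒copy f e = record
  { φ     = f
  ; inj   = orderEmbedding-injective e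
  ; order = λ x y → mk⇔
      (λ x⊂y → let (x⊆y , x≢y) = to ⊂⇔⊆×≢ x⊂y
               in from ⊂⇔⊆×≢ (to (e x y) x⊆y , x≢y ∘ orderEmbedding-injective e))
      (λ fx⊂fy → let (fx⊆fy , fx≢fy) = to ⊂⇔⊆×≢ fx⊂fy
                 in from ⊂⇔⊆×≢ (from (e x y) fx⊆fy , fx≢fy ∘ cong f))
  }

copy⇒orderEmbedding : (G : CopyOfB k N) → OrderEmbedding (φ G)
copy⇒orderEmbedding G x y = mk⇔ preserve reflect
  where
  preserve : x ⊆ y → φ G x ⊆ φ G y
  preserve x⊆y with x ≟ₛ y
  ... | yes x≡y = ⊆-reflexive (cong (φ G) x≡y)
  ... | no x≢y = proj₁ (to (order G x y) (from ⊂⇔⊆×≢ (x⊆y , x≢y)))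
  reflect : φ G x ⊆ φ G y → x ⊆ y
  reflect fx⊆fy with φ G x ≟ₛ φ G y
  ... | yes fx≡fy = ⊆-reflexive (inj G fx≡fy)
  ... | no fx≢fy = proj₁ (from (order G x y) (from ⊂⇔⊆×≢ (fx⊆fy , fx≢fy)))

∘-orderEmbedding : {f : Subset k → Subset N} {M : ℕ} {g : Subset N → Subset M} →
                   OrderEmbedding g → OrderEmbedding f → OrderEmbedding (g ∘ f)
∘-orderEmbedding eg ef x y = mk⇔ (to (eg _ _) ∘ to (ef x y)) (from (ef x y) ∘ from (eg _ _))

no-copy-in-B₀ : ¬ CopyOfB (suc k) 0
no-copy-in-B₀ G = ∉⊥ (subst (zero ∈_) (inj G (B₀-trivial _ _)) ∈⊤)
  where
  B₀-trivial : (p q : Subset 0) → p ≡ q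
  B₀-trivial [] [] = refl

-- Binary numeral with the first element as the most significant bit.
code : Subset k → ℕ
code [] = 0
code {suc k} (outside ∷ p) = code p
code {suc k} (inside ∷ p) = 2 ^ k + code p

code-∅ : ∀ k → code (∅ {k}) ≡ 0
code-∅ zero = refl
code-∅ (suc k) = code-∅ k

code<2^k : (p : Subset k) → code p < 2 ^ k
code<2^k [] = s≤s z≤n
code<2^k {suc k} (outside ∷ p) = <-≤-trans (code<2^k p) (m≤m+n (2 ^ k) (2 ^ k + 0))
code<2^k {suc k} (inside ∷ p) =
  +-monoʳ-< (2 ^ k) (subst (code p <_) (sym (+-identityʳ (2 ^ k))) (code<2^k p))

code-injective : Injective _≡_ _≡_ (code {k})
code-injective {x = []} {[]} _ = refl
code-injective {suc k} {outside ∷ p} {outside ∷ q} e = cong (outside ∷_) (code-injective e)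
code-injective {suc k} {inside ∷ p} {inside ∷ q} e =
  cong (inside ∷_) (code-injective (+-cancelˡ-≡ (2 ^ k) _ _ e))
code-injective {suc k} {outside ∷ p} {inside ∷ q} e =
  contradiction e (<⇒≢ (<-≤-trans (code<2^k p) (m≤m+n (2 ^ k) (code q))))
code-injective {suc k} {inside ∷ p} {outside ∷ q} e =
  contradiction (sym e) (<⇒≢ (<-≤-trans (code<2^k q) (m≤m+n (2 ^ k) (code p))))

code-nonempty : ∀ {k} {z : Subset k} → z ≢ ∅ → 1 ≤ code z
code-nonempty {k} {z} z≢∅ with code z in eq
... | zero = contradiction (code-injective (trans eq (sym (code-∅ k)))) z≢∅
... | suc _ = s≤s z≤n

Searchable : Set → Set₁
Searchable A = {P : A → Set} → Decidable P → Dec (∃ P)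

Extensional : {A B : Set} → ((A → B) → Set) → Set
Extensional P = ∀ {f g} → f ≗ g → P f → P g

all?-by-counterexample : {A : Set} {P : A → Set} → Decidable P → Dec (∃ λ x → ¬ P x) → Dec (∀ x → P x)
all?-by-counterexample P? (yes (x , ¬Px)) = no λ ∀P → ¬Px (∀P x)
all?-by-counterexample P? (no ∄¬P) = yes λ x → decidable-stable (P? x) λ ¬Px → ∄¬P (x , ¬Px)

allSubset? : {P : Subset k → Set} → Decidable P → Dec (∀ p → P p)
allSubset? P? = all?-by-counterexample P? (anySubset? (¬? ∘ P?))

anyFunction? : {B : Set} → Searchable B → ∀ k {P : (Subset k → B) → Set} →
               Extensional P → Decidable P → Dec (∃ P)
anyFunction? search zero {P} ext P? with search (λ b → P? λ _ → b)
... | yes (b , P[b]) = yes (_ , P[b])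
... | no ∄ = no λ (f , Pf) → ∄ (f [] , ext (λ { [] → refl }) Pf)
anyFunction? {B} search (suc k) {P} ext P? with anyFunction? search k extendable-ext extendable?
  where
  join : (Subset k → B) → (Subset k → B) → Subset (suc k) → B
  join f₀ f₁ (outside ∷ p) = f₀ p
  join f₀ f₁ (inside ∷ p) = f₁ p
  extendable : (Subset k → B) → Set
  extendable f₀ = ∃[ f₁ ] P (join f₀ f₁)
  extendable-ext : Extensional extendable
  extendable-ext f₀≗g₀ (f₁ , Pf) = f₁ , ext (λ { (outside ∷ p) → f₀≗g₀ p ; (inside ∷ p) → refl }) Pf
  extendable? : Decidable extendable
  extendable? f₀ = anyFunction? search k
    (λ f₁≗g₁ → ext λ { (outside ∷ p) → refl ; (inside ∷ p) → f₁≗g₁ p }) (P? ∘ join f₀)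
... | yes (f₀ , f₁ , Pf) = yes (_ , Pf)
... | no ∄ = no λ (f , Pf) →
  ∄ (f ∘ (outside ∷_) , f ∘ (inside ∷_) , ext (λ { (outside ∷ p) → refl ; (inside ∷ p) → refl }) Pf)

allFunction? : {B : Set} → Searchable B → ∀ k {P : (Subset k → B) → Set} →
               Extensional P → Decidable P → Dec (∀ f → P f)
allFunction? search k ext P? =
  all?-by-counterexample P? (anyFunction? search k (λ f≗g ¬Pf → ¬Pf ∘ ext (sym ∘ f≗g)) (¬? ∘ P?))

_⇔-dec_ : {A B : Set} → Dec A → Dec B → Dec (A ⇔ B)
a? ⇔-dec b? = map′ (λ (f , g) → mk⇔ f g) (λ e → to e , from e) ((a? →-dec b?) ×-dec (b? →-dec a?))

orderEmbedding? : (f : Subset k → Subset N) → Dec (OrderEmbedding f)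
orderEmbedding? f = allSubset? λ x → allSubset? λ y → (x ⊆? y) ⇔-dec (f x ⊆? f y)

orderEmbedding-ext : Extensional (OrderEmbedding {k} {N})
orderEmbedding-ext f≗g e x y = mk⇔
  (subst₂ _⊆_ (f≗g x) (f≗g y) ∘ to (e x y))
  (from (e x y) ∘ subst₂ _⊆_ (sym (f≗g x)) (sym (f≗g y)))

injective? : {C : Set} → DecidableEquality C → (g : Subset k → C) → Dec (Injective _≡_ _≡_ g)
injective? _≟ᶜ_ g = map′ (λ h {x} {y} → h x y) (λ h x y → h)
  (allSubset? λ x → allSubset? λ y → (g x ≟ᶜ g y) →-dec (x ≟ₛ y))

module _ {C : Set} (_≟ᶜ_ : DecidableEquality C) {N : ℕ} (c : Subset N → C) (k : ℕ) where

  MonoEmbedding RainbowEmbedding : (Subset k → Subset N) → Set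
  MonoEmbedding f = OrderEmbedding f × (∀ x y → c (f x) ≡ c (f y))
  RainbowEmbedding f = OrderEmbedding f × Injective _≡_ _≡_ (c ∘ f)

  hasMonoB? : Dec (HasMonoB k N c)
  hasMonoB? = map′ (λ (f , e , mono) → orderEmbedding⇒copy f e , mono)
                   (λ (G , mono) → φ G , copy⇒orderEmbedding G , mono)
    (anyFunction? anySubset? k {MonoEmbedding}
      (λ f≗g (e , mono) → orderEmbedding-ext f≗g e ,
                          λ x y → trans (cong c (sym (f≗g x))) (trans (mono x y) (cong c (f≗g y))))
      (λ f → orderEmbedding? f ×-dec allSubset? λ x → allSubset? λ y → c (f x) ≟ᶜ c (f y)))

  hasRainbowB? : Dec (HasRainbowB k N c)
  hasRainbowB? = map′ (λ (f , e , rainbow) → orderEmbedding⇒copy f e , λ {x} {y} → rainbow)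
                      (λ (G , rainbow) → φ G , copy⇒orderEmbedding G , λ {x} {y} → rainbow)
    (anyFunction? anySubset? k {RainbowEmbedding}
      (λ f≗g (e , rainbow) → orderEmbedding-ext f≗g e ,
                             λ cgx≡cgy →
                               rainbow (trans (cong c (f≗g _)) (trans cgx≡cgy (cong c (sym (f≗g _))))))
      (λ f → orderEmbedding? f ×-dec injective? _≟ᶜ_ (c ∘ f)))

MonoOrRainbow : {C : Set} → ℕ → ℕ → (N : ℕ) → (Subset N → C) → Set
MonoOrRainbow m n N c = HasMonoB m N c ⊎ HasRainbowB n N c

module _ {C D : Set} {N : ℕ} {c : Subset N → C} {d : Subset N → D} where

  hasMonoB-coarsen : ∀ {k} → (∀ {x y} → c x ≡ c y → d x ≡ d y) → HasMonoB k N c → HasMonoB k N d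
  hasMonoB-coarsen c⇒d (G , mono) = G , λ x y → c⇒d (mono x y)

  hasRainbowB-refine : ∀ {k} → (∀ {x y} → d x ≡ d y → c x ≡ c y) → HasRainbowB k N c → HasRainbowB k N d
  hasRainbowB-refine d⇒c (G , rainbow) = G , rainbow ∘ d⇒c

  monoOrRainbow-sameKernel : ∀ {m n} → (∀ {x y} → c x ≡ c y → d x ≡ d y) →
                             (∀ {x y} → d x ≡ d y → c x ≡ c y) →
                             MonoOrRainbow m n N c → MonoOrRainbow m n N d
  monoOrRainbow-sameKernel c⇒d d⇒c (inj₁ mono) = inj₁ (hasMonoB-coarsen c⇒d mono)
  monoOrRainbow-sameKernel c⇒d d⇒c (inj₂ rainbow) = inj₂ (hasRainbowB-refine d⇒c rainbow)

-- A colour class is named by one of its members: the colours of ℕ become colours in B_N.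
module _ {N : ℕ} (c : Subset N → ℕ) where

  representative : ℕ → Subset N
  representative v with anySubset? (λ y → c y ≟ v)
  ... | yes (y , _) = y
  ... | no _ = ∅

  representative-colour : ∀ x → c (representative (c x)) ≡ c x
  representative-colour x with anySubset? (λ y → c y ≟ c x)
  ... | yes (_ , cy≡cx) = cy≡cx
  ... | no ∄ = contradiction (x , refl) ∄

RRProp⇔subsetColourings : ∀ m n N → RRProp m n N ⇔ (∀ (d : Subset N → Subset N) → MonoOrRainbow m n N d)
RRProp⇔subsetColourings m n N = mk⇔
  (λ rr d → monoOrRainbow-sameKernel {c = code ∘ d} {d} code-injective (cong code) (rr (code ∘ d)))
  (λ rr c → monoOrRainbow-sameKernel {c = representative c ∘ c} {c}
     (λ {x} {y} e →
        trans (sym (representative-colour c x)) (trans (cong c e) (representative-colour c y)))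
     (cong (representative c))
     (rr (representative c ∘ c)))

RRProp? : ∀ m n N → Dec (RRProp m n N)
RRProp? m n N = map′ (from (RRProp⇔subsetColourings m n N)) (to (RRProp⇔subsetColourings m n N))
  (allFunction? anySubset? N
    (λ {f} {g} f≗g → monoOrRainbow-sameKernel {c = f} {g} (λ e → trans (sym (f≗g _)) (trans e (f≗g _)))
                                       (λ e → trans (f≗g _) (trans e (sym (f≗g _)))))
    (λ d → hasMonoB? _≟ₛ_ d m ⊎-dec hasRainbowB? _≟ₛ_ d n))

minimal : {P : ℕ → Set} → Decidable P → ∀ S → P S → ∃[ r ] IsMin P r × r ≤ S
minimal {P} P? = <-rec (λ S → P S → ∃[ r ] IsMin P r × r ≤ S) search
  where
  search : ∀ S → (∀ {S′} → S′ < S → P S′ → ∃[ r ] IsMin P r × r ≤ S′) → P S → ∃[ r ] IsMin P r × r ≤ S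
  search S below PS with anyUpTo? P? S
  ... | no ∄ = S , (PS , λ M PM → ≮⇒≥ λ M<S → ∄ (M , M<S , PM)) , ≤-refl
  ... | yes (S′ , S′<S , PS′) with below S′<S PS′
  ...   | r , isMin , r≤S′ = r , isMin , ≤-trans r≤S′ (<⇒≤ S′<S)

module _ (R : ℕ → ℕ) where

  assemble : ∀ K → ((i : ℕ) → Subset (R i)) → Subset (sumFrom1 R K)
  assemble zero f = []
  assemble (suc K) f = assemble K f ++ f (suc K)

  assemble-⊆⁺ : ∀ K {f g} → (∀ i → 1 ≤ i → i ≤ K → f i ⊆ g i) → assemble K f ⊆ assemble K g
  assemble-⊆⁺ zero _ = ⊆-refl
  assemble-⊆⁺ (suc K) f⊆g =
    ++-⊆⁺ (assemble-⊆⁺ K λ i 1≤i i≤K → f⊆g i 1≤i (m≤n⇒m≤1+n i≤K)) (f⊆g (suc K) (s≤s z≤n) ≤-refl)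

  assemble-⊆⁻ : ∀ K {f g} → assemble K f ⊆ assemble K g → ∀ i → 1 ≤ i → i ≤ K → f i ⊆ g i
  assemble-⊆⁻ zero _ i (s≤s _) ()
  assemble-⊆⁻ (suc K) {f} {g} h i 1≤i i≤1+K with m≤n⇒m<n∨m≡n i≤1+K
  ... | inj₁ i<1+K = assemble-⊆⁻ K (++-⊆⁻ˡ {p = assemble K f} {assemble K g} h) i 1≤i (≤-pred i<1+K)
  ... | inj₂ refl = ++-⊆⁻ʳ {p = assemble K f} {assemble K g} h

  assemble-cong : ∀ K {f g} → (∀ i → 1 ≤ i → i ≤ K → f i ≡ g i) → assemble K f ≡ assemble K g
  assemble-cong K f≡g = ⊆-antisym
    (assemble-⊆⁺ K λ i 1≤i i≤K → ⊆-reflexive (f≡g i 1≤i i≤K))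
    (assemble-⊆⁺ K λ i 1≤i i≤K → ⊆-reflexive (sym (f≡g i 1≤i i≤K)))

module Layers (n : ℕ) (R : ℕ → ℕ) where

  K S : ℕ
  K = 2 ^ n ∸ 1
  S = sumFrom1 R K

  code≤K : (z : Subset n) → code z ≤ K
  code≤K z = subst (code z ≤_) (pred[m∸n]≡m∸[1+n] (2 ^ n) 0) (suc[m]≤n⇒m≤pred[n] (code<2^k z))

  Below : Subset n → ℕ → Set
  Below z i = ∃[ z′ ] z′ ⊂ z × code z′ ≡ i

  below? : ∀ z i → Dec (Below z i)
  below? z i = anySubset? λ z′ → z′ ⊂? z ×-dec code z′ ≟ i

  layer : (z : Subset n) → Subset (R (code z)) → (i : ℕ) → Subset (R i)
  layer z w i with below? z i | i ≟ code z
  ... | yes _ | _ = full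
  ... | no _ | yes refl = w
  ... | no _ | no _ = ∅

  ψ : (z : Subset n) → Subset (R (code z)) → Subset S
  ψ z w = assemble R K (layer z w)

  layer-below : ∀ {z w i} → Below z i → layer z w i ≡ full
  layer-below {z} {w} {i} b with below? z i
  ... | yes _ = refl
  ... | no ¬b = contradiction b ¬b

  layer-self : ∀ {z w} → layer z w (code z) ≡ w
  layer-self {z} {w} with below? z (code z) | code z ≟ code z
  ... | yes (z′ , z′⊂z , e) | _ = contradiction z′⊂z (⊂-irref (code-injective e))
  ... | no _ | yes refl = refl
  ... | no _ | no ≢ = contradiction refl ≢

  layer-outside : ∀ {z w} {a : Subset n} → a ⊈ z → layer z w (code a) ≡ ∅
  layer-outside {z} {w} {a} a⊈z with below? z (code a) | code a ≟ code z
  ... | yes (a′ , a′⊂z , e) | _ = ⊥-elim (a⊈z (subst (λ b → b ⊆ z) (code-injective e) (proj₁ a′⊂z)))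
  ... | no _ | yes e = ⊥-elim (a⊈z (⊆-reflexive (code-injective e)))
  ... | no _ | no _ = refl

  layer-elsewhere : ∀ {z w i} → ¬ Below z i → i ≢ code z → layer z w i ≡ ∅
  layer-elsewhere {z} {w} {i} ¬b i≢code with below? z i | i ≟ code z
  ... | yes b | _ = contradiction b ¬b
  ... | no _ | yes e = contradiction e i≢code
  ... | no _ | no _ = refl

  ¬below-atom : ∀ {z i} → (∀ {z′} → z′ ⊂ z → z′ ≡ ∅) → 1 ≤ i → ¬ Below z i
  ¬below-atom only∅ 1≤i (z′ , z′⊂z , e) =
    <⇒≢ 1≤i (trans (sym (code-∅ n)) (trans (cong code (sym (only∅ z′⊂z))) e))

  layer-mono : ∀ {z w w′} i → w ⊆ w′ → layer z w i ⊆ layer z w′ i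
  layer-mono {z} i w⊆w′ with below? z i | i ≟ code z
  ... | yes _ | _ = ⊆-refl
  ... | no _ | yes refl = w⊆w′
  ... | no _ | no _ = ⊆-refl

  layer-⊂ : ∀ {z z′ w w′} i → z ⊂ z′ → layer z w i ⊆ layer z′ w′ i
  layer-⊂ {z} {z′} {w} {w′} i z⊂z′ with below? z i | i ≟ code z
  ... | yes (a , a⊂z , e) | _ = ⊆-reflexive (sym (layer-below (a , ⊂-trans a⊂z z⊂z′ , e)))
  ... | no _ | yes refl = subst (w ⊆_) (sym (layer-below (z , z⊂z′ , refl))) ⊆⊤
  ... | no _ | no _ = ⊥⊆

  layer-block : ∀ {z z′ w w′} → ψ z w ⊆ ψ z′ w′ → (a : Subset n) → a ≢ ∅ →
                layer z w (code a) ⊆ layer z′ w′ (code a)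
  layer-block ψ⊆ψ a a≢∅ = assemble-⊆⁻ R K ψ⊆ψ (code a) (code-nonempty a≢∅) (code≤K a)

  ψ-orderEmbedding : (z : Subset n) → z ≢ ∅ → OrderEmbedding (ψ z)
  ψ-orderEmbedding z z≢∅ w w′ = mk⇔ preserve reflect
    where
    preserve : w ⊆ w′ → ψ z w ⊆ ψ z w′
    preserve w⊆w′ = assemble-⊆⁺ R K λ i _ _ → layer-mono i w⊆w′
    reflect : ψ z w ⊆ ψ z w′ → w ⊆ w′
    reflect ψ⊆ψ = subst₂ _⊆_ layer-self layer-self (layer-block ψ⊆ψ z z≢∅)

  ψ-⊂ : ∀ {z z′} w w′ → z ⊂ z′ → ψ z w ⊆ ψ z′ w′
  ψ-⊂ w w′ z⊂z′ = assemble-⊆⁺ R K λ i _ _ → layer-⊂ i z⊂z′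

  blank : Subset S
  blank = assemble R K λ _ → ∅

  ψ-∅ : ∀ w → ψ ∅ w ≡ blank
  ψ-∅ w = assemble-cong R K λ i 1≤i _ →
    layer-elsewhere (¬below-atom (λ (_ , x , x∈∅ , _) → contradiction x∈∅ ∉⊥) 1≤i)
                    (λ i≡code∅ → <⇒≢ 1≤i (sym (trans i≡code∅ (code-∅ n))))

  ψ-⁅x⁆ : ∀ x → ψ ⁅ x ⁆ ∅ ≡ blank
  ψ-⁅x⁆ x = assemble-cong R K λ i 1≤i _ → blank-layer 1≤i (i ≟ code ⁅ x ⁆)
    where
    blank-layer : ∀ {i} → 1 ≤ i → Dec (i ≡ code ⁅ x ⁆) → layer ⁅ x ⁆ ∅ i ≡ ∅
    blank-layer _ (yes refl) = layer-self
    blank-layer 1≤i (no i≢code) = layer-elsewhere (¬below-atom ⊂⁅x⁆⇒≡∅ 1≤i) i≢code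

  ψ-reflects : ∀ {z z′ w w′} → (∀ i → 1 ≤ i → 1 ≤ R i) → (∀ {x} → z ≡ ⁅ x ⁆ → w ≢ ∅) →
               ψ z w ⊆ ψ z′ w′ → z ⊆ z′
  ψ-reflects {z} {z′} {w} {w′} R-positive atom-nonblank ψ⊆ψ with z ⊆? z′
  ... | yes z⊆z′ = z⊆z′
  ... | no z⊈z′ with ⊈⇒∃∈∉ z⊈z′
  ...   | x , x∈z , x∉z′ with ⁅ x ⁆ ≟ₛ z
  ...     | yes ⁅x⁆≡z = contradiction (⊆-antisym w⊆∅ ⊥⊆) (atom-nonblank (sym ⁅x⁆≡z))
    where
    w⊆∅ : w ⊆ ∅
    w⊆∅ = subst₂ _⊆_ layer-self (layer-outside z⊈z′) (layer-block ψ⊆ψ z (⁅x⁆≢∅ ∘ trans ⁅x⁆≡z))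
  ...     | no ⁅x⁆≢z = ⊥-elim (full⊈∅ (R-positive (code ⁅ x ⁆) (code-nonempty (⁅x⁆≢∅ {x = x}))) full⊆∅)
    where
    full⊆∅ : full ⊆ ∅
    full⊆∅ = subst₂ _⊆_ (layer-below (⁅ x ⁆ , from ⊂⇔⊆×≢ (x∈p⇒⁅x⁆⊆p x∈z , ⁅x⁆≢z) , refl))
                        (layer-outside λ ⁅x⁆⊆z′ → x∉z′ (⁅x⁆⊆z′ (x∈⁅x⁆ x)))
                        (layer-block ψ⊆ψ ⁅ x ⁆ ⁅x⁆≢∅)

RProp-positive : ∀ {m} → 1 ≤ m → 1 ≤ k → RProp k m N → 1 ≤ N
RProp-positive {k = suc _} {zero} (s≤s _) _ ramsey = ⊥-elim (no-copy-in-B₀ (proj₁ (ramsey λ _ → zero)))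
RProp-positive {N = suc _} _ _ _ = s≤s z≤n

module Greedy (n m : ℕ) (R : ℕ → ℕ) (R-Ramsey : ∀ i → 1 ≤ i → RProp i m (R i))
              (c : Subset (Layers.S n R) → ℕ) where
  open Layers n R

  Choice : Set
  Choice = (z : Subset n) → Subset (R (code z))

  colour : Choice → Subset n → ℕ
  colour W z = c (ψ z (W z))

  DistinctBelow : Choice → ℕ → Set
  DistinctBelow W j = ∀ {z z′} → code z < j → code z′ < j → colour W z ≡ colour W z′ → z ≡ z′

  _[_≔_] : Choice → (z : Subset n) → Subset (R (code z)) → Choice
  (W [ z ≔ w ]) z′ with z′ ≟ₛ z
  ... | yes refl = w
  ... | no _ = W z′

  OldColour : Choice → (z : Subset n) → Subset (R (code z)) → Set
  OldColour W z w = ∃[ z′ ] code z′ < code z × c (ψ z w) ≡ colour W z′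

  oldColour? : ∀ W z w → Dec (OldColour W z w)
  oldColour? W z w = anySubset? λ z′ → code z′ <? code z ×-dec c (ψ z w) ≟ colour W z′

  module _ (W : Choice) (z : Subset n) (w : Subset (R (code z))) where

    colour-≔-at : ∀ {a} → code a ≡ code z → colour (W [ z ≔ w ]) a ≡ c (ψ z w)
    colour-≔-at {a} a=z with a ≟ₛ z
    ... | yes refl = refl
    ... | no a≢z = contradiction (code-injective a=z) a≢z

    colour-≔-below : ∀ {a} → code a < code z → colour (W [ z ≔ w ]) a ≡ colour W a
    colour-≔-below {a} a<z with a ≟ₛ z
    ... | yes refl = contradiction refl (<⇒≢ a<z)
    ... | no _ = refl

    distinct-≔ : DistinctBelow W (code z) → ¬ OldColour W z w →
                 DistinctBelow (W [ z ≔ w ]) (suc (code z))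
    distinct-≔ distinct fresh {a} {b} a≤z b≤z e with m<1+n⇒m<n∨m≡n a≤z | m<1+n⇒m<n∨m≡n b≤z
    ... | inj₁ a<z | inj₁ b<z =
      distinct a<z b<z (trans (sym (colour-≔-below a<z)) (trans e (colour-≔-below b<z)))
    ... | inj₂ a=z | inj₂ b=z = trans (code-injective {x = a} {y = z} a=z) (sym (code-injective b=z))
    ... | inj₂ a=z | inj₁ b<z =
      ⊥-elim (fresh (b , b<z , trans (sym (colour-≔-at a=z)) (trans e (colour-≔-below b<z))))
    ... | inj₁ a<z | inj₂ b=z =
      ⊥-elim (fresh (a , a<z , trans (sym (colour-≔-at b=z)) (trans (sym e) (colour-≔-below a<z))))

  -- Colouring w by the code of an earlier subset sharing its colour is a (code z)-colouring.
  monochromatic-if-no-fresh : ∀ W z → (∀ w → OldColour W z w) → HasMonoB m S c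
  monochromatic-if-no-fresh W z old =
    orderEmbedding⇒copy (ψ z ∘ φ G) (∘-orderEmbedding (ψ-orderEmbedding z z≢∅) (copy⇒orderEmbedding G)) ,
    λ x y → trans (proj₂ (proj₂ (old (φ G x))))
              (trans (cong (colour W) (same-old (d-mono x y))) (sym (proj₂ (proj₂ (old (φ G y))))))
    where
    1≤code : 1 ≤ code z
    1≤code = ≤-trans (s≤s z≤n) (proj₁ (proj₂ (old ∅)))
    z≢∅ : z ≢ ∅
    z≢∅ z≡∅ = <⇒≢ 1≤code (sym (trans (cong code z≡∅) (code-∅ n)))
    d : Subset (R (code z)) → Fin (code z)
    d w = fromℕ< (proj₁ (proj₂ (old w)))
    same-old : ∀ {w w′} → d w ≡ d w′ → proj₁ (old w) ≡ proj₁ (old w′)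
    same-old dw≡dw′ =
      code-injective (trans (sym (toℕ-fromℕ< _)) (trans (cong toℕ dw≡dw′) (toℕ-fromℕ< _)))
    G : CopyOfB m (R (code z))
    G = proj₁ (R-Ramsey (code z) 1≤code d)
    d-mono : ∀ x y → d (φ G x) ≡ d (φ G y)
    d-mono = proj₂ (R-Ramsey (code z) 1≤code d)

  extend : ∀ {j} (W : Choice) (z : Subset n) → code z ≡ j → DistinctBelow W j →
           HasMonoB m S c ⊎ ∃[ W′ ] DistinctBelow W′ (suc j)
  extend W z refl distinct with anySubset? (¬? ∘ oldColour? W z)
  ... | yes (w , fresh) = inj₂ (W [ z ≔ w ] , distinct-≔ W z w distinct fresh)
  ... | no ∄fresh = inj₁ (monochromatic-if-no-fresh W z λ w →
                      decidable-stable (oldColour? W z w) λ fresh → ∄fresh (w , fresh))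

  step : ∀ j W → DistinctBelow W j → HasMonoB m S c ⊎ ∃[ W′ ] DistinctBelow W′ (suc j)
  step j W distinct with anySubset? (λ z → code z ≟ j)
  ... | yes (z , code≡j) = extend W z code≡j distinct
  ... | no ∄ = inj₂ (W , λ {a} {b} a≤j b≤j → distinct (below-j {a} a≤j) (below-j {b} b≤j))
    where
    below-j : ∀ {a} → code a < suc j → code a < j
    below-j {a} a≤j with m<1+n⇒m<n∨m≡n a≤j
    ... | inj₁ a<j = a<j
    ... | inj₂ a=j = contradiction (a , a=j) ∄

  greedy : ∀ j → HasMonoB m S c ⊎ ∃[ W ] DistinctBelow W j
  greedy zero = inj₂ ((λ _ → ∅) , λ ())
  greedy (suc j) with greedy j
  ... | inj₁ mono = inj₁ mono
  ... | inj₂ (W , distinct) = step j W distinct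

  rainbow-if-distinct : 1 ≤ m → ∀ W → DistinctBelow W (2 ^ n) → HasRainbowB n S c
  rainbow-if-distinct 1≤m W distinct =
    orderEmbedding⇒copy (λ z → ψ z (W z)) embedding , λ {x} {y} → distinct (code<2^k x) (code<2^k y)
    where
    atom-nonblank : ∀ {z x} → z ≡ ⁅ x ⁆ → W z ≢ ∅
    atom-nonblank {x = x} refl W⁅x⁆≡∅ = ⁅x⁆≢∅ (distinct (code<2^k ⁅ x ⁆) (code<2^k (∅ {n})) (begin
      c (ψ ⁅ x ⁆ (W ⁅ x ⁆)) ≡⟨ cong (c ∘ ψ ⁅ x ⁆) W⁅x⁆≡∅ ⟩
      c (ψ ⁅ x ⁆ ∅)         ≡⟨ cong c (ψ-⁅x⁆ x) ⟩
      c blank               ≡⟨ cong c (sym (ψ-∅ (W ∅))) ⟩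
      c (ψ ∅ (W ∅))         ∎))
      where open ≡-Reasoning
    monotone : ∀ {z z′} → z ⊆ z′ → ψ z (W z) ⊆ ψ z′ (W z′)
    monotone {z} {z′} z⊆z′ with z ≟ₛ z′
    ... | yes refl = ⊆-refl
    ... | no z≢z′ = ψ-⊂ (W z) (W z′) (from ⊂⇔⊆×≢ (z⊆z′ , z≢z′))
    embedding : OrderEmbedding (λ z → ψ z (W z))
    embedding z z′ = mk⇔ monotone
      (ψ-reflects (λ i 1≤i → RProp-positive 1≤m 1≤i (R-Ramsey i 1≤i)) atom-nonblank)

  monoOrRainbow : 1 ≤ m → MonoOrRainbow m n S c
  monoOrRainbow 1≤m with greedy (2 ^ n)
  ... | inj₁ mono = inj₁ mono
  ... | inj₂ (W , distinct) = inj₂ (rainbow-if-distinct 1≤m W distinct)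

RRProp-sumFrom1 : ∀ m n (R : ℕ → ℕ) → 1 ≤ m → (∀ i → 1 ≤ i → RProp i m (R i)) →
                  RRProp m n (sumFrom1 R (2 ^ n ∸ 1))
RRProp-sumFrom1 m n R 1≤m R-Ramsey c = Greedy.monoOrRainbow n m R R-Ramsey c 1≤m

mainTheorem11 : (m n : ℕ) → 1 ≤ m → 1 ≤ n →
    (R : ℕ → ℕ) → (∀ i → 1 ≤ i → IsMin (RProp i m) (R i)) →
    Σ ℕ (λ rr → IsMin (RRProp m n) rr × rr ≤ sumFrom1 R (2 ^ n ∸ 1))
mainTheorem11 m n 1≤m _ R R-isMin =
  minimal (RRProp? m n) (sumFrom1 R (2 ^ n ∸ 1))
    (RRProp-sumFrom1 m n R 1≤m λ i 1≤i → proj₁ (R-isMin i 1≤i))
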